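{- Let $\ell\ge3$ be an integer and let $x<y<z$ be consecutive numbers in $\overline{\mathcal{V}}_\ell$. Then $y\notin\overline{\mathcal{V}}_{\ell+1}$ if and only if $y-x\ne z-y$. When these equivalent conditions hold, we further have $z-x=\bar\alpha(y)=F_\ell$.
   Context: Fibonacci numbers: $F_{ -1}=0$, $F_0=1$, $F_{i+2}=F_{i+1}+F_i$; $\overline{\mathcal{F}}=\{F_i: i\ge-1\}$. Define $\bar\iota:\mathbb{N}\to\mathbb{N}$ by $\bar\iota(x)=x$ if $x\in\overline{\mathcal{F}}$, and $\bar\iota(x)=x-2F_{i-2}$ if $F_i<x<F_{i+1}$ for an integer $i\ge3$; $\bar\alpha(x)=\lim_k\bar\iota^k(x)$; $\overline{\mathcal{V}}_\ell=\{x\in\mathbb{N}: \bar\alpha(x)\ge F_\ell\}$. Elements $x_1<\dots<x_k$ of $\overline{\mathcal{V}}_\ell$ are consecutive if they are all the elements of $\overline{\mathcal{V}}_\ell\cap[x_1,x_k]$. -}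

module Defs where

open import Data.Nat using (ℕ; zero; suc; _+_; _*_; _∸_; _≤_; _<_; _<ᵇ_; _≡ᵇ_)
open import Data.Bool using (Bool; true; false; if_then_else_; _∨_; _∧_)
open import Data.List using (List; []; _∷_; map; upTo)
open import Data.Bool.ListAction using (any)
open import Data.Maybe using (Maybe; just; nothing)
open import Data.Sum using (_⊎_)
open import Data.Product using (_×_)
open import Relation.Binary.PropositionalEquality using (_≡_)

-- fib i = F_i for i ≥ 0  (F_0 = 1, F_1 = 1, F_{i+2} = F_{i+1} + F_i).
-- The extra value F_{-1} = 0 is handled explicitly in isFibᵇ.
fib : ℕ → ℕ
fib zero = 1
fib (suc zero) = 1
fib (suc (suc i)) = fib (suc i) + fib i

-- membership in \overline{F} = {F_i : i ≥ -1} = {0} ∪ {F_i : i ≥ 0}.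
-- Since F_i ≥ i, it suffices to search indices i < x + 2.
isFibᵇ : ℕ → Bool
isFibᵇ x = (x ≡ᵇ 0) ∨ any (λ i → fib i ≡ᵇ x) (upTo (suc (suc x)))

firstIdx : (ℕ → Bool) → List ℕ → Maybe ℕ
firstIdx p [] = nothing
firstIdx p (i ∷ is) = if p i then just i else firstIdx p is

-- \bar ι(x) = x if x ∈ \overline{F};
-- \bar ι(x) = x - 2 F_{i-2} if F_i < x < F_{i+1} with i ≥ 3
-- (the index i is searched among 3, …, x + 2; for non-Fibonacci x it always exists and is unique).
iotaBarAux : ℕ → Maybe ℕ → ℕ
iotaBarAux x (just i) = x ∸ 2 * fib (i ∸ 2)
iotaBarAux x nothing  = x

iotaBar : ℕ → ℕ
iotaBar x =
  if isFibᵇ x then x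
  else iotaBarAux x (firstIdx (λ i → (fib i <ᵇ x) ∧ (x <ᵇ fib (suc i)))
                              (map (3 +_) (upTo x)))

iter : ℕ → (ℕ → ℕ) → ℕ → ℕ
iter zero f x = x
iter (suc k) f x = f (iter k f x)

-- \bar α(x) = lim_k \bar ι^k(x).  Since \bar ι(x) < x whenever x is not a
-- fixed point (and 0 is a fixed point), the sequence is constant from k = x on,
-- so the limit equals \bar ι^x(x).
alphaBar : ℕ → ℕ
alphaBar x = iter x iotaBar x

V : ℕ → ℕ → Set
V ℓ x = fib ℓ ≤ alphaBar x

Consecutive3 : ℕ → ℕ → ℕ → ℕ → Set
Consecutive3 ℓ x y z =
  V ℓ x × V ℓ y × V ℓ z × x < y × y < z ×
  (∀ w → x ≤ w → w ≤ z → V ℓ w → (w ≡ x ⊎ w ≡ y ⊎ w ≡ z))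

{-# OPTIONS --safe #-}
module Submission where

open import Defs
open import Data.Bool using (Bool; true; false; T; _∧_)
open import Data.Bool.Properties using (T-∧; T-∨)
open import Data.Empty using (⊥; ⊥-elim)
open import Data.List using (_∷_; map; upTo)
open import Data.List.Membership.Propositional using (_∈_; lose)
open import Data.List.Membership.Propositional.Properties using (∈-map⁺; ∈-upTo⁺)
open import Data.List.Relation.Unary.Any using (here; there; satisfied)
open import Data.List.Relation.Unary.Any.Properties using (any⁺; any⁻)
open import Data.Maybe using (just; nothing)
open import Data.Nat
open import Data.Nat.Induction using (<-rec)
open import Data.Nat.Properties
open import Data.Nat.Tactic.RingSolver using (solve-∀)
open import Data.Product using (∃-syntax; _×_; _,_; proj₂)
open import Data.Sum as Sum using (_⊎_; inj₁; inj₂)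
open import Function using (_∘_; Equivalence)
open import Relation.Binary.Definitions using (tri<; tri≈; tri>)
open import Relation.Binary.PropositionalEquality
open import Relation.Nullary using (¬_; yes; no; contradiction)

-- Write F_i for fib i. On F_{n+3} < u < F_{n+4}, ι̅ subtracts 2F_{n+1}, sending F_{n+3} + a to F_n + a, and ᾱ is
-- ι̅-invariant. Applying this once or twice shows that w ↦ 2F_{n+3} + w preserves ᾱ on the window
-- F_n < w < F_{n+2} + F_{n+4} except at w = F_{n+2} (sent to F_{n+5}). Hence, for ℓ ≤ n + 2, a triple in the window
-- is consecutive in V̄_ℓ when its translate is, and translating preserves the differences and, for the middle
-- element, both membership in V̄_{ℓ+1} and the value ᾱ = F_ℓ. Every consecutive triple with middle element
-- y > F_{ℓ+3} is such a translate of a triple with a smaller middle element, so by strong induction on y everything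
-- reduces to the six triples with middle element in (F_ℓ, F_{ℓ+3}], which are computed directly.

strict-offset : ∀ {p w} → p < w → ∃[ a ] 0 < a × p + a ≡ w
strict-offset {p} {w} p<w = w ∸ p , m<n⇒0<n∸m p<w , m+[n∸m]≡n (<⇒≤ p<w)

fib>0 : ∀ n → 0 < fib n
fib>0 zero = z<s
fib>0 (suc zero) = z<s
fib>0 (suc (suc n)) = <-≤-trans (fib>0 (suc n)) (m≤m+n _ _)

fib-≤-suc : ∀ n → fib n ≤ fib (suc n)
fib-≤-suc zero = ≤-refl
fib-≤-suc (suc n) = m≤m+n _ _

fib-<-suc : ∀ n → fib (suc n) < fib (2 + n)
fib-<-suc n = m<m+n (fib (suc n)) (fib>0 n)

fib-mono-≤ : ∀ {i j} → i ≤ j → fib i ≤ fib j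
fib-mono-≤ {j = zero} z≤n = ≤-refl
fib-mono-≤ {j = suc j} i≤1+j with m≤n⇒m<n∨m≡n i≤1+j
... | inj₁ i<1+j = ≤-trans (fib-mono-≤ (≤-pred i<1+j)) (fib-≤-suc j)
... | inj₂ refl = ≤-refl

fib-suc-mono-< : ∀ {i j} → i < j → fib (suc i) < fib (suc j)
fib-suc-mono-< {i} i<j = <-≤-trans (fib-<-suc i) (fib-mono-≤ (s≤s i<j))

n≤fib[n] : ∀ n → n ≤ fib n
n≤fib[n] zero = z≤n
n≤fib[n] (suc zero) = ≤-refl
n≤fib[n] (suc (suc n)) = ≤-trans (s≤s (n≤fib[n] (suc n))) (fib-<-suc n)

fib-bracket : ∀ {i y} → fib i ≤ y → ∃[ j ] i ≤ j × fib j ≤ y × y < fib (suc j)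
fib-bracket {i} {y} fib[i]≤y = search (suc y) (<-≤-trans (n<1+n y) (n≤fib[n] (suc y)))
  where
  search : ∀ j → y < fib j → ∃[ j′ ] i ≤ j′ × fib j′ ≤ y × y < fib (suc j′)
  search zero y<1 = ⊥-elim (<⇒≱ y<1 (≤-trans (fib>0 i) fib[i]≤y))
  search (suc j) y<fib[1+j] with fib j ≤? y
  ... | yes fib[j]≤y =
    j , ≮⇒≥ (λ j<i → <⇒≱ y<fib[1+j] (≤-trans (fib-mono-≤ j<i) fib[i]≤y)) , fib[j]≤y , y<fib[1+j]
  ... | no fib[j]≰y = search j (≰⇒> fib[j]≰y)

fib-bracket-unique : ∀ {i j u} → fib i < u → u < fib (suc i) → fib j < u → u < fib (suc j) → i ≡ j
fib-bracket-unique {i} {j} fib[i]<u u<fib[1+i] fib[j]<u u<fib[1+j] with <-cmp i j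
... | tri< i<j _ _ = ⊥-elim (<⇒≱ u<fib[1+i] (≤-trans (fib-mono-≤ i<j) (<⇒≤ fib[j]<u)))
... | tri≈ _ i≡j _ = i≡j
... | tri> _ _ j<i = ⊥-elim (<⇒≱ u<fib[1+j] (≤-trans (fib-mono-≤ j<i) (<⇒≤ fib[i]<u)))

fib≢-bracket : ∀ {i u} j → fib i < u → u < fib (suc i) → fib j ≢ u
fib≢-bracket {i} j fib[i]<u u<fib[1+i] refl with j ≤? i
... | yes j≤i = <⇒≱ fib[i]<u (fib-mono-≤ j≤i)
... | no j≰i = <⇒≱ u<fib[1+i] (fib-mono-≤ (≰⇒> j≰i))

fib[3+n]≡2*fib[1+n]+fib[n] : ∀ n → fib (3 + n) ≡ 2 * fib (1 + n) + fib n
fib[3+n]≡2*fib[1+n]+fib[n] n = identity (fib (1 + n)) (fib n)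
  where
  identity : ∀ p q → (p + q) + p ≡ 2 * p + q
  identity = solve-∀

2*fib[3+n]+[fib[n]+a]≡fib[4+n]+[fib[2+n]+a] : ∀ n a →
  2 * fib (3 + n) + (fib n + a) ≡ fib (4 + n) + (fib (2 + n) + a)
2*fib[3+n]+[fib[n]+a]≡fib[4+n]+[fib[2+n]+a] n a = identity (fib (1 + n)) (fib n) a
  where
  identity : ∀ p q a → 2 * ((p + q) + p) + (q + a) ≡ (((p + q) + p) + (p + q)) + ((p + q) + a)
  identity = solve-∀

2*fib[3+n]+[fib[2+n]+fib[4+n]]≡fib[6+n] : ∀ n → 2 * fib (3 + n) + (fib (2 + n) + fib (4 + n)) ≡ fib (6 + n)
2*fib[3+n]+[fib[2+n]+fib[4+n]]≡fib[6+n] n =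
  trans (sym (+-assoc (2 * fib (3 + n)) (fib (2 + n)) (fib (4 + n))))
        (cong (_+ fib (4 + n)) (sym (fib[3+n]≡2*fib[1+n]+fib[n] (2 + n))))

isFibᵇ-fib : ∀ j → T (isFibᵇ (fib j))
isFibᵇ-fib j =
  Equivalence.from (T-∨ {fib j ≡ᵇ 0})
    (inj₂ (any⁺ (λ i → fib i ≡ᵇ fib j) (lose j∈ (≡⇒≡ᵇ (fib j) (fib j) refl))))
  where
  j∈ : j ∈ upTo (2 + fib j)
  j∈ = ∈-upTo⁺ (≤-trans (s≤s (n≤fib[n] j)) (n≤1+n _))

¬isFibᵇ-bracket : ∀ {i u} → fib i < u → u < fib (suc i) → ¬ T (isFibᵇ u)
¬isFibᵇ-bracket {i} {u} fib[i]<u u<fib[1+i] isFib with Equivalence.to (T-∨ {u ≡ᵇ 0}) isFib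
... | inj₁ u≡0 = <⇒≢ (<-trans (fib>0 i) fib[i]<u) (sym (≡ᵇ⇒≡ u 0 u≡0))
... | inj₂ found with satisfied (any⁻ (λ j → fib j ≡ᵇ u) (upTo (2 + u)) found)
...   | j , fib[j]≡u = fib≢-bracket {i} j fib[i]<u u<fib[1+i] (≡ᵇ⇒≡ (fib j) u fib[j]≡u)

firstIdx-unique : ∀ {p : ℕ → Bool} {j l} → (∀ {i} → T (p i) → i ≡ j) → T (p j) → j ∈ l →
                  firstIdx p l ≡ just j
firstIdx-unique {p} {l = i ∷ l} unique pj j∈ with p i in eq
... | true = cong just (unique (subst T (sym eq) _))
... | false with j∈
...   | here refl = ⊥-elim (subst T eq pj)
...   | there j∈l = firstIdx-unique unique pj j∈l

iotaBar-fib : ∀ j → iotaBar (fib j) ≡ fib j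
iotaBar-fib j with isFibᵇ (fib j) | isFibᵇ-fib j
... | true | _ = refl

iotaBar-bracket : ∀ n {u} → fib (3 + n) < u → u < fib (4 + n) → iotaBar u ≡ u ∸ 2 * fib (1 + n)
iotaBar-bracket n {u} lo hi with isFibᵇ u in eq
... | true = ⊥-elim (¬isFibᵇ-bracket {3 + n} lo hi (subst T (sym eq) _))
... | false = cong (iotaBarAux u) (firstIdx-unique unique (Equivalence.from T-∧ (<⇒<ᵇ lo , <⇒<ᵇ hi)) 3+n∈)
  where
  unique : ∀ {i} → T ((fib i <ᵇ u) ∧ (u <ᵇ fib (suc i))) → i ≡ 3 + n
  unique {i} inside with Equivalence.to T-∧ inside
  ... | below , above = fib-bracket-unique {j = 3 + n} (<ᵇ⇒< (fib i) u below) (<ᵇ⇒< u (fib (suc i)) above) lo hi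
  3+n∈ : 3 + n ∈ map (3 +_) (upTo u)
  3+n∈ = ∈-map⁺ (3 +_) (∈-upTo⁺ (≤-<-trans (≤-trans (m≤n+m n 3) (n≤fib[n] (3 + n))) lo))

iotaBar-≤ : ∀ u → iotaBar u ≤ u
iotaBar-≤ u with isFibᵇ u
... | true = ≤-refl
... | false with firstIdx (λ i → (fib i <ᵇ u) ∧ (u <ᵇ fib (suc i))) (map (3 +_) (upTo u))
...   | just i = m∸n≤m u (2 * fib (i ∸ 2))
...   | nothing = ≤-refl

module _ {f : ℕ → ℕ} where

  iter-suc-inner : ∀ k x → iter (suc k) f x ≡ iter k f (f x)
  iter-suc-inner zero x = refl
  iter-suc-inner (suc k) x = cong f (iter-suc-inner k x)

  iter-+ : ∀ k l x → iter (k + l) f x ≡ iter k f (iter l f x)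
  iter-+ zero l x = refl
  iter-+ (suc k) l x = cong f (iter-+ k l x)

  iter-fix : ∀ {x} k → f x ≡ x → iter k f x ≡ x
  iter-fix zero fx≡x = refl
  iter-fix (suc k) fx≡x = trans (cong f (iter-fix k fx≡x)) fx≡x

  module _ (deflationary : ∀ x → f x ≤ x) where

    iter-≤ : ∀ k x → iter k f x ≤ x
    iter-≤ zero x = ≤-refl
    iter-≤ (suc k) x = ≤-trans (deflationary _) (iter-≤ k x)

    iter-fixpoint : ∀ {k x} → x ≤ k → f (iter k f x) ≡ iter k f x
    iter-fixpoint {zero} z≤n = n≤0⇒n≡0 (deflationary 0)
    iter-fixpoint {suc k} {x} x≤1+k with m≤n⇒m<n∨m≡n (deflationary x)
    ... | inj₂ fx≡x = trans (cong f (iter-fix (suc k) fx≡x)) (trans fx≡x (sym (iter-fix (suc k) fx≡x)))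
    ... | inj₁ fx<x =
      subst (λ t → f t ≡ t) (sym (iter-suc-inner k x)) (iter-fixpoint (≤-pred (<-≤-trans fx<x x≤1+k)))

    iter-stable : ∀ {k x} → x ≤ k → iter k f x ≡ iter x f x
    iter-stable {k} {x} x≤k with m≤n⇒∃[o]m+o≡n x≤k
    ... | d , refl = begin
      iter (x + d) f x        ≡⟨ cong (λ t → iter t f x) (+-comm x d) ⟩
      iter (d + x) f x        ≡⟨ iter-+ d x x ⟩
      iter d f (iter x f x)   ≡⟨ iter-fix d (iter-fixpoint {x} ≤-refl) ⟩
      iter x f x              ∎
      where open ≡-Reasoning

alphaBar-≤ : ∀ u → alphaBar u ≤ u
alphaBar-≤ u = iter-≤ iotaBar-≤ u u

alphaBar-fib : ∀ j → alphaBar (fib j) ≡ fib j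
alphaBar-fib j = iter-fix (fib j) (iotaBar-fib j)

alphaBar-iotaBar : ∀ u → alphaBar (iotaBar u) ≡ alphaBar u
alphaBar-iotaBar zero = cong alphaBar (n≤0⇒n≡0 (iotaBar-≤ 0))
alphaBar-iotaBar (suc u) with m≤n⇒m<n∨m≡n (iotaBar-≤ (suc u))
... | inj₂ ι≡u = cong alphaBar ι≡u
... | inj₁ ι<u = begin
  iter (iotaBar (suc u)) iotaBar (iotaBar (suc u))  ≡⟨ sym (iter-stable iotaBar-≤ (≤-pred ι<u)) ⟩
  iter u iotaBar (iotaBar (suc u))                  ≡⟨ sym (iter-suc-inner u (suc u)) ⟩
  alphaBar (suc u)                                  ∎
  where open ≡-Reasoning

alphaBar-shift : ∀ n {a} → 0 < a → a < fib (2 + n) → alphaBar (fib (3 + n) + a) ≡ alphaBar (fib n + a)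
alphaBar-shift n {a} 0<a a<fib[2+n] = begin
  alphaBar (fib (3 + n) + a)               ≡⟨ sym (alphaBar-iotaBar (fib (3 + n) + a)) ⟩
  alphaBar (iotaBar (fib (3 + n) + a))     ≡⟨ cong alphaBar ι[fib[3+n]+a]≡fib[n]+a ⟩
  alphaBar (fib n + a)                     ∎
  where
  open ≡-Reasoning
  D : ℕ
  D = 2 * fib (1 + n)
  ι[fib[3+n]+a]≡fib[n]+a : iotaBar (fib (3 + n) + a) ≡ fib n + a
  ι[fib[3+n]+a]≡fib[n]+a = begin
    iotaBar (fib (3 + n) + a)   ≡⟨ iotaBar-bracket n (m<m+n _ 0<a) (+-monoʳ-< (fib (3 + n)) a<fib[2+n]) ⟩
    fib (3 + n) + a ∸ D         ≡⟨ cong (λ t → t + a ∸ D) (fib[3+n]≡2*fib[1+n]+fib[n] n) ⟩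
    D + fib n + a ∸ D           ≡⟨ cong (_∸ D) (+-assoc D (fib n) a) ⟩
    D + (fib n + a) ∸ D         ≡⟨ m+n∸m≡n D (fib n + a) ⟩
    fib n + a                   ∎

alphaBar-shift-fib : ∀ n {a} j → 0 < a → a < fib (2 + n) → fib n + a ≡ fib j →
                     alphaBar (fib (3 + n) + a) ≡ fib j
alphaBar-shift-fib n {a} j 0<a a<fib[2+n] fib[n]+a≡fib[j] =
  trans (alphaBar-shift n 0<a a<fib[2+n]) (trans (cong alphaBar fib[n]+a≡fib[j]) (alphaBar-fib j))

alphaBar-window-above : ∀ n {a} → 0 < a → a < fib (4 + n) →
                        alphaBar (2 * fib (3 + n) + (fib (2 + n) + a)) ≡ alphaBar (fib (2 + n) + a)
alphaBar-window-above n {a} 0<a a<fib[4+n] = begin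
  alphaBar (2 * fib (3 + n) + (fib (2 + n) + a))
    ≡⟨ cong alphaBar (sym (+-assoc (2 * fib (3 + n)) (fib (2 + n)) a)) ⟩
  alphaBar (2 * fib (3 + n) + fib (2 + n) + a)
    ≡⟨ cong (λ t → alphaBar (t + a)) (sym (fib[3+n]≡2*fib[1+n]+fib[n] (2 + n))) ⟩
  alphaBar (fib (5 + n) + a)
    ≡⟨ alphaBar-shift (2 + n) 0<a a<fib[4+n] ⟩
  alphaBar (fib (2 + n) + a)
    ∎
  where open ≡-Reasoning

alphaBar-window-below : ∀ n {a} → 0 < a → a < fib (1 + n) →
                        alphaBar (2 * fib (3 + n) + (fib n + a)) ≡ alphaBar (fib n + a)
alphaBar-window-below n {a} 0<a a<fib[1+n] = begin
  alphaBar (2 * fib (3 + n) + (fib n + a))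
    ≡⟨ cong alphaBar (2*fib[3+n]+[fib[n]+a]≡fib[4+n]+[fib[2+n]+a] n a) ⟩
  alphaBar (fib (4 + n) + (fib (2 + n) + a))
    ≡⟨ alphaBar-shift (1 + n) (<-≤-trans 0<a (m≤n+m a _)) (+-monoʳ-< (fib (2 + n)) a<fib[1+n]) ⟩
  alphaBar (fib (1 + n) + (fib (2 + n) + a))
    ≡⟨ cong alphaBar (sym (+-assoc (fib (1 + n)) (fib (2 + n)) a)) ⟩
  alphaBar (fib (1 + n) + fib (2 + n) + a)
    ≡⟨ cong (λ t → alphaBar (t + a)) (+-comm (fib (1 + n)) (fib (2 + n))) ⟩
  alphaBar (fib (3 + n) + a)
    ≡⟨ alphaBar-shift n 0<a (<-trans a<fib[1+n] (fib-<-suc n)) ⟩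
  alphaBar (fib n + a)
    ∎
  where open ≡-Reasoning

alphaBar-window : ∀ n {w} → fib n < w → w < fib (2 + n) + fib (4 + n) → w ≢ fib (2 + n) →
                  alphaBar (2 * fib (3 + n) + w) ≡ alphaBar w
alphaBar-window n {w} lo hi w≢fib[2+n] with <-cmp w (fib (2 + n))
... | tri≈ _ w≡fib[2+n] _ = ⊥-elim (w≢fib[2+n] w≡fib[2+n])
... | tri< w<fib[2+n] _ _ with strict-offset lo
...   | a , 0<a , refl =
  alphaBar-window-below n 0<a
    (+-cancelˡ-< (fib n) a (fib (1 + n)) (subst (fib n + a <_) (+-comm (fib (1 + n)) (fib n)) w<fib[2+n]))
alphaBar-window n {w} lo hi _ | tri> _ _ fib[2+n]<w with strict-offset fib[2+n]<w
...   | a , 0<a , refl = alphaBar-window-above n 0<a (+-cancelˡ-< (fib (2 + n)) a (fib (4 + n)) hi)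

module _ (ℓ : ℕ) where

  V-alphaBar≡fib : ∀ w {j} → alphaBar w ≡ fib j → ℓ ≤ j → V ℓ w
  V-alphaBar≡fib _ αw≡fib[j] ℓ≤j = subst (fib ℓ ≤_) (sym αw≡fib[j]) (fib-mono-≤ ℓ≤j)

  V-fib : ∀ {j} → ℓ ≤ j → V ℓ (fib j)
  V-fib {j} = V-alphaBar≡fib (fib j) (alphaBar-fib j)

  V⇒fib≤ : ∀ {w} → V ℓ w → fib ℓ ≤ w
  V⇒fib≤ {w} v = ≤-trans v (alphaBar-≤ w)

  V-window-up : ∀ n {w} → ℓ ≤ 5 + n → fib n < w → w ≤ fib (2 + n) + fib (4 + n) →
                V ℓ w → V ℓ (2 * fib (3 + n) + w)
  V-window-up n {w} ℓ≤5+n lo hi v with w ≟ fib (2 + n) | m≤n⇒m<n∨m≡n hi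
  ... | yes refl | _ = subst (V ℓ) (fib[3+n]≡2*fib[1+n]+fib[n] (2 + n)) (V-fib ℓ≤5+n)
  ... | no _ | inj₂ refl =
    subst (V ℓ) (sym (2*fib[3+n]+[fib[2+n]+fib[4+n]]≡fib[6+n] n)) (V-fib (≤-trans ℓ≤5+n (n≤1+n _)))
  ... | no w≢fib[2+n] | inj₁ w<top = subst (fib ℓ ≤_) (sym (alphaBar-window n lo w<top w≢fib[2+n])) v

  V-window-down : ∀ n {w} → ℓ ≤ 2 + n → fib n < w → w ≤ fib (2 + n) + fib (4 + n) →
                  V ℓ (2 * fib (3 + n) + w) → V ℓ w
  V-window-down n {w} ℓ≤2+n lo hi v with w ≟ fib (2 + n) | m≤n⇒m<n∨m≡n hi
  ... | yes refl | _ = V-fib ℓ≤2+n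
  ... | no _ | inj₂ refl =
    V-alphaBar≡fib (fib (2 + n) + fib (4 + n))
      (trans (cong alphaBar (+-comm (fib (2 + n)) (fib (4 + n))))
             (alphaBar-shift-fib (1 + n) (3 + n) (fib>0 (2 + n)) (fib-<-suc (1 + n))
                                 (+-comm (fib (1 + n)) (fib (2 + n)))))
      (≤-trans ℓ≤2+n (n≤1+n _))
  ... | no w≢fib[2+n] | inj₁ w<top = subst (fib ℓ ≤_) (alphaBar-window n lo w<top w≢fib[2+n]) v

  alphaBar≡fib[ℓ]⇒≢fib : ∀ {x y} j → V ℓ x → x < y → alphaBar y ≡ fib ℓ → y ≢ fib j
  alphaBar≡fib[ℓ]⇒≢fib {x} j vx x<y αy≡fib[ℓ] refl =
    <⇒≱ x<y (subst (_≤ x) (trans (sym αy≡fib[ℓ]) (alphaBar-fib j)) (V⇒fib≤ vx))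

  Gap : ℕ → ℕ → Set
  Gap p q = p < q × (∀ {w} → p < w → w < q → ¬ V ℓ w)

  gap-below : ∀ {p q} → p < q → q ≤ fib ℓ → Gap p q
  gap-below p<q q≤fib[ℓ] = p<q , λ _ w<q v → <⇒≱ (<-≤-trans w<q q≤fib[ℓ]) (V⇒fib≤ v)

  gap-mono : ∀ {p q p′ q′} → Gap p q → p ≤ p′ → q′ ≤ q → p′ < q′ → Gap p′ q′
  gap-mono (_ , empty) p≤p′ q′≤q p′<q′ = p′<q′ , λ lo hi → empty (≤-<-trans p≤p′ lo) (<-≤-trans hi q′≤q)

  gap-shift : ∀ n {a b} → b ≤ fib (2 + n) → Gap (fib n + a) (fib n + b) → Gap (fib (3 + n) + a) (fib (3 + n) + b)
  gap-shift n {a} {b} b≤fib[2+n] (p<q , empty) = +-monoʳ-< (fib (3 + n)) (+-cancelˡ-< (fib n) a b p<q) , empty′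
    where
    empty′ : ∀ {w} → fib (3 + n) + a < w → w < fib (3 + n) + b → ¬ V ℓ w
    empty′ lo hi with strict-offset (≤-<-trans (m≤m+n _ a) lo)
    ... | c , 0<c , refl =
      empty (+-monoʳ-< (fib n) a<c) (+-monoʳ-< (fib n) c<b)
      ∘ subst (fib ℓ ≤_) (alphaBar-shift n 0<c (<-≤-trans c<b b≤fib[2+n]))
      where
      a<c : a < c
      a<c = +-cancelˡ-< (fib (3 + n)) a c lo
      c<b : c < b
      c<b = +-cancelˡ-< (fib (3 + n)) c b hi

  gap-shift₀ : ∀ n {b} → b ≤ fib (2 + n) → Gap (fib n) (fib n + b) → Gap (fib (3 + n)) (fib (3 + n) + b)
  gap-shift₀ n {b} b≤fib[2+n] =
    subst (λ p → Gap p (fib (3 + n) + b)) (+-identityʳ (fib (3 + n)))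
    ∘ gap-shift n {0} b≤fib[2+n]
    ∘ subst (λ p → Gap p (fib n + b)) (sym (+-identityʳ (fib n)))

  V-between-gaps : ∀ {p c q y} → Gap p c → Gap c q → p < y → y < q → V ℓ y → y ≡ c
  V-between-gaps {c = c} {y = y} (_ , emptyˡ) (_ , emptyʳ) p<y y<q vy with <-cmp y c
  ... | tri< y<c _ _ = ⊥-elim (emptyˡ p<y y<c vy)
  ... | tri≈ _ y≡c _ = y≡c
  ... | tri> _ _ c<y = ⊥-elim (emptyʳ c<y y<q vy)

  Consecutive3-below : ∀ {x y z w} → Consecutive3 ℓ x y z → V ℓ w → w < y → w ≤ x
  Consecutive3-below {x} {w = w} (_ , _ , _ , _ , y<z , only) vw w<y with w ≤? x
  ... | yes w≤x = w≤x
  ... | no w≰x with only w (<⇒≤ (≰⇒> w≰x)) (<⇒≤ (<-trans w<y y<z)) vw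
  ...   | inj₁ w≡x = ⊥-elim (w≰x (≤-reflexive w≡x))
  ...   | inj₂ (inj₁ w≡y) = ⊥-elim (<-irrefl w≡y w<y)
  ...   | inj₂ (inj₂ w≡z) = ⊥-elim (<-irrefl w≡z (<-trans w<y y<z))

  Consecutive3-above : ∀ {x y z w} → Consecutive3 ℓ x y z → V ℓ w → y < w → z ≤ w
  Consecutive3-above {z = z} {w} (_ , _ , _ , x<y , _ , only) vw y<w with z ≤? w
  ... | yes z≤w = z≤w
  ... | no z≰w with only w (<⇒≤ (<-trans x<y y<w)) (<⇒≤ (≰⇒> z≰w)) vw
  ...   | inj₁ w≡x = ⊥-elim (<-irrefl (sym w≡x) (<-trans x<y y<w))
  ...   | inj₂ (inj₁ w≡y) = ⊥-elim (<-irrefl (sym w≡y) y<w)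
  ...   | inj₂ (inj₂ w≡z) = ⊥-elim (z≰w (≤-reflexive (sym w≡z)))

  Consecutive3-neighbours : ∀ {x y z p q} → Consecutive3 ℓ x y z → Gap p y → V ℓ p → Gap y q → V ℓ q →
                            x ≡ p × z ≡ q
  Consecutive3-neighbours c@(vx , _ , vz , x<y , y<z , _) (p<y , emptyˡ) vp (y<q , emptyʳ) vq =
    ≤-antisym (≮⇒≥ λ p<x → emptyˡ p<x x<y vx) (Consecutive3-below c vp p<y) ,
    ≤-antisym (Consecutive3-above c vq y<q) (≮⇒≥ λ z<q → emptyʳ y<z z<q vz)

Balanced Unbalanced Dichotomy : ℕ → ℕ → ℕ → ℕ → Set
Balanced ℓ x y z = V (suc ℓ) y × y ∸ x ≡ z ∸ y
Unbalanced ℓ x y z = alphaBar y ≡ fib ℓ × y ∸ x ≢ z ∸ y × z ∸ x ≡ fib ℓ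
Dichotomy ℓ x y z = Balanced ℓ x y z ⊎ Unbalanced ℓ x y z

module _ (ℓ n : ℕ) (ℓ≤2+n : ℓ ≤ 2 + n) {x y z : ℕ}
         (fib[n]<x : fib n < x) (z≤top : z ≤ fib (2 + n) + fib (4 + n)) where

  private
    D : ℕ
    D = 2 * fib (3 + n)

  Consecutive3-untranslate : Consecutive3 ℓ (D + x) (D + y) (D + z) → Consecutive3 ℓ x y z
  Consecutive3-untranslate (vx , vy , vz , D+x<D+y , D+y<D+z , only) =
    down ≤-refl x≤top vx , down (<⇒≤ x<y) y≤top vy , down (<⇒≤ (<-trans x<y y<z)) z≤top vz ,
    x<y , y<z , only′
    where
    x<y : x < y
    x<y = +-cancelˡ-< D x y D+x<D+y
    y<z : y < z
    y<z = +-cancelˡ-< D y z D+y<D+z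
    y≤top : y ≤ fib (2 + n) + fib (4 + n)
    y≤top = ≤-trans (<⇒≤ y<z) z≤top
    x≤top : x ≤ fib (2 + n) + fib (4 + n)
    x≤top = ≤-trans (<⇒≤ x<y) y≤top
    down : ∀ {w} → x ≤ w → w ≤ fib (2 + n) + fib (4 + n) → V ℓ (D + w) → V ℓ w
    down x≤w = V-window-down ℓ n ℓ≤2+n (<-≤-trans fib[n]<x x≤w)
    only′ : ∀ w → x ≤ w → w ≤ z → V ℓ w → w ≡ x ⊎ w ≡ y ⊎ w ≡ z
    only′ w x≤w w≤z vw =
      Sum.map (+-cancelˡ-≡ D w x) (Sum.map (+-cancelˡ-≡ D w y) (+-cancelˡ-≡ D w z))
        (only (D + w) (+-monoʳ-≤ D x≤w) (+-monoʳ-≤ D w≤z)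
          (V-window-up ℓ n (≤-trans ℓ≤2+n (m≤n+m (2 + n) 3)) (<-≤-trans fib[n]<x x≤w) (≤-trans w≤z z≤top)
            vw))

  Dichotomy-translate : Consecutive3 ℓ x y z → Dichotomy ℓ x y z → Dichotomy ℓ (D + x) (D + y) (D + z)
  Dichotomy-translate (vx , _ , _ , x<y , y<z , _) = Sum.map translate-balanced translate-unbalanced
    where
    fib[n]<y : fib n < y
    fib[n]<y = <-trans fib[n]<x x<y
    y<top : y < fib (2 + n) + fib (4 + n)
    y<top = <-≤-trans y<z z≤top
    Δ : ∀ a b → (D + a) ∸ (D + b) ≡ a ∸ b
    Δ = [m+n]∸[m+o]≡n∸o D
    translate-balanced : Balanced ℓ x y z → Balanced ℓ (D + x) (D + y) (D + z)
    translate-balanced (vy , y∸x≡z∸y) =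
      V-window-up (suc ℓ) n (≤-trans (s≤s ℓ≤2+n) (m≤n+m (3 + n) 2)) fib[n]<y (<⇒≤ y<top) vy ,
      trans (Δ y x) (trans y∸x≡z∸y (sym (Δ z y)))
    translate-unbalanced : Unbalanced ℓ x y z → Unbalanced ℓ (D + x) (D + y) (D + z)
    translate-unbalanced (αy≡fib[ℓ] , y∸x≢z∸y , width) =
      trans (alphaBar-window n fib[n]<y y<top (alphaBar≡fib[ℓ]⇒≢fib ℓ (2 + n) vx x<y αy≡fib[ℓ]))
            αy≡fib[ℓ] ,
      (λ eq → y∸x≢z∸y (trans (sym (Δ y x)) (trans eq (Δ z y)))) ,
      trans (Δ z x) width

-- F k is F_{ℓ-3+k}. In [F_ℓ, F_{ℓ+3}] the elements of V̄_ℓ are F_ℓ, F_{ℓ+1}, F_{ℓ+1} + F_{ℓ-1}, F_{ℓ+2},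
-- F_{ℓ+2} + F_{ℓ-2}, F_{ℓ+2} + F_ℓ and F_{ℓ+3}.
module Classification (m : ℕ) where

  ℓ : ℕ
  ℓ = 3 + m

  F : ℕ → ℕ
  F k = fib (k + m)

  gap[F3,F4] : Gap ℓ (F 3) (F 4)
  gap[F3,F4] =
    gap-shift₀ ℓ m ≤-refl
      (gap-below ℓ (m<m+n (F 0) (fib>0 (2 + m)))
        (≤-trans (≤-reflexive (+-comm (F 0) (F 2))) (+-monoʳ-≤ (F 2) (fib-≤-suc m))))

  gap[F4,F4+F2] : Gap ℓ (F 4) (F 4 + F 2)
  gap[F4,F4+F2] =
    gap-shift₀ ℓ (1 + m) (fib-≤-suc (2 + m))
      (gap-below ℓ (m<m+n (F 1) (fib>0 (2 + m))) (≤-reflexive (+-comm (F 1) (F 2))))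

  gap[F4+F2,F5] : Gap ℓ (F 4 + F 2) (F 5)
  gap[F4+F2,F5] =
    gap-shift ℓ (1 + m) ≤-refl
      (gap-mono ℓ gap[F3,F4] (≤-reflexive (+-comm (F 2) (F 1)))
        (≤-trans (≤-reflexive (+-comm (F 1) (F 3))) (+-monoʳ-≤ (F 3) (fib-≤-suc (1 + m))))
        (+-monoʳ-< (F 1) (fib-<-suc (1 + m))))

  gap[F5,F5+F1] : Gap ℓ (F 5) (F 5 + F 1)
  gap[F5,F5+F1] =
    gap-shift₀ ℓ (2 + m) (fib-mono-≤ (m≤n+m (1 + m) 3)) (gap-below ℓ (m<m+n (F 2) (fib>0 (1 + m))) ≤-refl)

  gap[F5+F1,F5+F3] : Gap ℓ (F 5 + F 1) (F 5 + F 3)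
  gap[F5+F1,F5+F3] =
    gap-shift ℓ (2 + m) (fib-≤-suc (3 + m))
      (gap-mono ℓ gap[F3,F4] ≤-refl (≤-reflexive (+-comm (F 2) (F 3)))
        (+-monoʳ-< (F 2) (<-≤-trans (fib-<-suc m) (fib-≤-suc (2 + m)))))

  gap[F5+F3,F6] : Gap ℓ (F 5 + F 3) (F 6)
  gap[F5+F3,F6] =
    gap-shift ℓ (2 + m) ≤-refl
      (gap-mono ℓ gap[F4,F4+F2] (≤-reflexive (+-comm (F 3) (F 2))) (≤-reflexive (+-comm (F 2) (F 4)))
        (+-monoʳ-< (F 2) (fib-<-suc (2 + m))))

  gap[F6,F6+F2] : Gap ℓ (F 6) (F 6 + F 2)
  gap[F6,F6+F2] = gap-shift₀ ℓ (3 + m) (fib-mono-≤ (m≤n+m (2 + m) 3)) gap[F3,F4]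

  α[F4+F2] : alphaBar (F 4 + F 2) ≡ F 3
  α[F4+F2] = alphaBar-shift-fib (1 + m) (3 + m) (fib>0 (2 + m)) (fib-<-suc (1 + m)) (+-comm (F 1) (F 2))

  α[F5+F1] : alphaBar (F 5 + F 1) ≡ F 3
  α[F5+F1] = alphaBar-shift-fib (2 + m) (3 + m) (fib>0 (1 + m)) (fib-suc-mono-< (m≤n+m (1 + m) 2)) refl

  α[F5+F3] : alphaBar (F 5 + F 3) ≡ F 4
  α[F5+F3] = alphaBar-shift-fib (2 + m) (4 + m) (fib>0 (3 + m)) (fib-<-suc (2 + m)) (+-comm (F 2) (F 3))

  α[F6+F2] : alphaBar (F 6 + F 2) ≡ F 4
  α[F6+F2] = alphaBar-shift-fib (3 + m) (4 + m) (fib>0 (2 + m)) (fib-suc-mono-< (m≤n+m (2 + m) 2)) refl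

  balanced : ∀ x y z d → V (suc ℓ) y → y ∸ x ≡ d → z ∸ y ≡ d → Dichotomy ℓ x y z
  balanced _ _ _ d vy y∸x≡d z∸y≡d = inj₁ (vy , trans y∸x≡d (sym z∸y≡d))

  unbalanced : ∀ x y z d e → alphaBar y ≡ fib ℓ → y ∸ x ≡ d → z ∸ y ≡ e → d ≢ e → z ∸ x ≡ fib ℓ →
               Dichotomy ℓ x y z
  unbalanced _ _ _ d e αy≡fib[ℓ] y∸x≡d z∸y≡e d≢e width =
    inj₂ (αy≡fib[ℓ] , (λ y∸x≡z∸y → d≢e (trans (sym y∸x≡d) (trans y∸x≡z∸y z∸y≡e))) , width)

  F1<F2 : F 1 < F 2
  F1<F2 = fib-<-suc m

  below-F4 : ∀ {x y z} → Consecutive3 ℓ x y z → y < F 4 → ⊥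
  below-F4 (vx , vy , _ , x<y , _) y<F4 = proj₂ gap[F3,F4] (≤-<-trans (V⇒fib≤ ℓ vx) x<y) y<F4 vy

  from-F4-to-F5 : ∀ {x y z} → Consecutive3 ℓ x y z → F 4 ≤ y → y < F 5 → Dichotomy ℓ x y z
  from-F4-to-F5 c F4≤y y<F5 with m≤n⇒m<n∨m≡n F4≤y
  ... | inj₂ refl
    with Consecutive3-neighbours ℓ c gap[F3,F4] (V-fib ℓ ≤-refl)
                                     gap[F4,F4+F2] (V-alphaBar≡fib ℓ (F 4 + F 2) α[F4+F2] ≤-refl)
  ...   | refl , refl =
    balanced (F 3) (F 4) (F 4 + F 2) (F 2) (V-fib (suc ℓ) ≤-refl) (m+n∸m≡n (F 3) (F 2)) (m+n∸m≡n (F 4) (F 2))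
  from-F4-to-F5 c@(_ , vy , _) F4≤y y<F5 | inj₁ F4<y with V-between-gaps ℓ gap[F4,F4+F2] gap[F4+F2,F5] F4<y y<F5 vy
  ... | refl
    with Consecutive3-neighbours ℓ c gap[F4,F4+F2] (V-fib ℓ (n≤1+n _)) gap[F4+F2,F5] (V-fib ℓ (m≤n+m _ 2))
  ...   | refl , refl =
    unbalanced (F 4) (F 4 + F 2) (F 5) (F 2) (F 1) α[F4+F2] (m+n∸m≡n (F 4) (F 2))
      (trans ([m+n]∸[m+o]≡n∸o (F 4) (F 3) (F 2)) (m+n∸m≡n (F 2) (F 1)))
      (≢-sym (<⇒≢ F1<F2)) (m+n∸m≡n (F 4) (F 3))

  from-F5-to-F6 : ∀ {x y z} → Consecutive3 ℓ x y z → F 5 ≤ y → y < F 6 → Dichotomy ℓ x y z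
  from-F5-to-F6 c F5≤y y<F6 with m≤n⇒m<n∨m≡n F5≤y
  ... | inj₂ refl
    with Consecutive3-neighbours ℓ c gap[F4+F2,F5] (V-alphaBar≡fib ℓ (F 4 + F 2) α[F4+F2] ≤-refl)
                                     gap[F5,F5+F1] (V-alphaBar≡fib ℓ (F 5 + F 1) α[F5+F1] ≤-refl)
  ...   | refl , refl =
    balanced (F 4 + F 2) (F 5) (F 5 + F 1) (F 1) (V-fib (suc ℓ) (n≤1+n _))
      (trans ([m+n]∸[m+o]≡n∸o (F 4) (F 3) (F 2)) (m+n∸m≡n (F 2) (F 1))) (m+n∸m≡n (F 5) (F 1))
  from-F5-to-F6 {y = y} c@(_ , vy , _) F5≤y y<F6 | inj₁ F5<y with <-cmp y (F 5 + F 3)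
  ... | tri< y<F5+F3 _ _ with V-between-gaps ℓ gap[F5,F5+F1] gap[F5+F1,F5+F3] F5<y y<F5+F3 vy
  ...   | refl
    with Consecutive3-neighbours ℓ c gap[F5,F5+F1] (V-fib ℓ (m≤n+m _ 2))
                                     gap[F5+F1,F5+F3] (V-alphaBar≡fib ℓ (F 5 + F 3) α[F5+F3] (n≤1+n _))
  ...     | refl , refl =
    unbalanced (F 5) (F 5 + F 1) (F 5 + F 3) (F 1) (F 2) α[F5+F1] (m+n∸m≡n (F 5) (F 1))
      (trans ([m+n]∸[m+o]≡n∸o (F 5) (F 3) (F 1)) (m+n∸n≡m (F 2) (F 1))) (<⇒≢ F1<F2) (m+n∸m≡n (F 5) (F 3))
  from-F5-to-F6 c F5≤y y<F6 | inj₁ F5<y | tri≈ _ refl _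
    with Consecutive3-neighbours ℓ c gap[F5+F1,F5+F3] (V-alphaBar≡fib ℓ (F 5 + F 1) α[F5+F1] ≤-refl)
                                     gap[F5+F3,F6] (V-fib ℓ (m≤n+m _ 3))
  ... | refl , refl =
    balanced (F 5 + F 1) (F 5 + F 3) (F 6) (F 2) (V-alphaBar≡fib (suc ℓ) (F 5 + F 3) α[F5+F3] ≤-refl)
      (trans ([m+n]∸[m+o]≡n∸o (F 5) (F 3) (F 1)) (m+n∸n≡m (F 2) (F 1)))
      (trans ([m+n]∸[m+o]≡n∸o (F 5) (F 4) (F 3)) (m+n∸m≡n (F 3) (F 2)))
  from-F5-to-F6 (_ , vy , _) F5≤y y<F6 | inj₁ F5<y | tri> _ _ F5+F3<y =
    ⊥-elim (proj₂ gap[F5+F3,F6] F5+F3<y y<F6 vy)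

  at-F6 : ∀ {x z} → Consecutive3 ℓ x (F 6) z → Dichotomy ℓ x (F 6) z
  at-F6 c with Consecutive3-neighbours ℓ c gap[F5+F3,F6] (V-alphaBar≡fib ℓ (F 5 + F 3) α[F5+F3] (n≤1+n _))
                                          gap[F6,F6+F2] (V-alphaBar≡fib ℓ (F 6 + F 2) α[F6+F2] (n≤1+n _))
  ... | refl , refl =
    balanced (F 5 + F 3) (F 6) (F 6 + F 2) (F 2) (V-fib (suc ℓ) (m≤n+m _ 2))
      (trans ([m+n]∸[m+o]≡n∸o (F 5) (F 4) (F 3)) (m+n∸m≡n (F 3) (F 2))) (m+n∸m≡n (F 6) (F 2))

  Classified : ℕ → Set
  Classified y = ∀ {x z} → Consecutive3 ℓ x y z → Dichotomy ℓ x y z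

  by-translation : ∀ n {x y z} → 1 + m ≤ n → (∀ {y′} → y′ < y → Classified y′) →
                   2 * fib (3 + n) + fib n < x → y < fib (6 + n) → Consecutive3 ℓ x y z → Dichotomy ℓ x y z
  by-translation n 1+m≤n rec lo y<fib[6+n] c@(_ , _ , _ , x<y , y<z , _)
    with m≤n⇒∃[o]m+o≡n (≤-trans (m≤m+n (2 * fib (3 + n)) (fib n)) (<⇒≤ lo))
  ... | x′ , refl with m≤n⇒∃[o]m+o≡n (≤-trans (m≤m+n (2 * fib (3 + n)) x′) (<⇒≤ x<y))
  ...   | y′ , refl with m≤n⇒∃[o]m+o≡n (≤-trans (m≤m+n (2 * fib (3 + n)) y′) (<⇒≤ y<z))
  ...     | z′ , refl =
    Dichotomy-translate ℓ n ℓ≤2+n fib[n]<x′ z′≤top c′ (rec (m<n+m y′ (*-monoʳ-< 2 (fib>0 (3 + n)))) c′)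
    where
    D : ℕ
    D = 2 * fib (3 + n)
    ℓ≤2+n : ℓ ≤ 2 + n
    ℓ≤2+n = s≤s (s≤s 1+m≤n)
    fib[n]<x′ : fib n < x′
    fib[n]<x′ = +-cancelˡ-< D (fib n) x′ lo
    z′≤top : z′ ≤ fib (2 + n) + fib (4 + n)
    z′≤top = +-cancelˡ-≤ D z′ _
               (subst (D + z′ ≤_) (sym (2*fib[3+n]+[fib[2+n]+fib[4+n]]≡fib[6+n] n))
                 (Consecutive3-above ℓ c (V-fib ℓ (≤-trans ℓ≤2+n (m≤n+m _ 4))) y<fib[6+n]))
    c′ : Consecutive3 ℓ x′ y′ z′
    c′ = Consecutive3-untranslate ℓ n ℓ≤2+n fib[n]<x′ z′≤top c

  lower-bound-inside : ∀ n {x y z} → 1 + m ≤ n → Consecutive3 ℓ x y z → fib (5 + n) < y →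
                       2 * fib (3 + n) + fib n < x
  lower-bound-inside n {x} 1+m≤n c fib[5+n]<y =
    <-≤-trans (+-monoʳ-< (2 * fib (3 + n)) (≤-<-trans (fib-≤-suc n) (fib-<-suc n)))
      (subst (_≤ x) (fib[3+n]≡2*fib[1+n]+fib[n] (2 + n))
        (Consecutive3-below ℓ c (V-fib ℓ (≤-trans (s≤s (s≤s 1+m≤n)) (m≤n+m _ 3))) fib[5+n]<y))

  lower-bound-at-fib : ∀ n {x z} → 2 + m ≤ n → Consecutive3 ℓ x (fib (5 + n)) z → 2 * fib (3 + n) + fib n < x
  lower-bound-at-fib (suc n) (s≤s 1+m≤n) c =
    <-≤-trans (+-monoʳ-< D (fib-<-suc n))
      (Consecutive3-below ℓ c (V-window-up ℓ (suc n) (≤-trans ℓ≤2+n (m≤n+m _ 4)) (fib-<-suc n) fib[2+n]≤top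
                                             (V-fib ℓ ℓ≤2+n))
                              D+fib[2+n]<fib[6+n])
    where
    D : ℕ
    D = 2 * fib (4 + n)
    ℓ≤2+n : ℓ ≤ 2 + n
    ℓ≤2+n = s≤s (s≤s 1+m≤n)
    fib[2+n]≤top : fib (2 + n) ≤ fib (3 + n) + fib (5 + n)
    fib[2+n]≤top = ≤-trans (fib-≤-suc (2 + n)) (m≤m+n _ _)
    D+fib[2+n]<fib[6+n] : D + fib (2 + n) < fib (6 + n)
    D+fib[2+n]<fib[6+n] = subst (D + fib (2 + n) <_) (sym (fib[3+n]≡2*fib[1+n]+fib[n] (3 + n)))
                                (+-monoʳ-< D (fib-<-suc (1 + n)))

  beyond-F6 : ∀ {x y z} → (∀ {y′} → y′ < y → Classified y′) → F 6 ≤ y → Consecutive3 ℓ x y z →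
              Dichotomy ℓ x y z
  beyond-F6 rec F6≤y c with fib-bracket {6 + m} F6≤y
  ... | suc (suc (suc (suc (suc n)))) , s≤s (s≤s (s≤s (s≤s (s≤s 1+m≤n)))) , fib[5+n]≤y , y<fib[6+n]
    with m≤n⇒m<n∨m≡n fib[5+n]≤y | m≤n⇒m<n∨m≡n 1+m≤n
  ...   | inj₂ refl | inj₂ refl = at-F6 c
  ...   | inj₁ fib[5+n]<y | _ = by-translation n 1+m≤n rec (lower-bound-inside n 1+m≤n c fib[5+n]<y) y<fib[6+n] c
  ...   | inj₂ refl | inj₁ 2+m≤n = by-translation n 1+m≤n rec (lower-bound-at-fib n 2+m≤n c) y<fib[6+n] c

  classify-step : ∀ y → (∀ {y′} → y′ < y → Classified y′) → Classified y
  classify-step y rec c with y <? F 4 | y <? F 5 | y <? F 6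
  ... | yes y<F4 | _ | _ = ⊥-elim (below-F4 c y<F4)
  ... | no y≮F4 | yes y<F5 | _ = from-F4-to-F5 c (≮⇒≥ y≮F4) y<F5
  ... | _ | no y≮F5 | yes y<F6 = from-F5-to-F6 c (≮⇒≥ y≮F5) y<F6
  ... | _ | _ | no y≮F6 = beyond-F6 rec (≮⇒≥ y≮F6) c

  classify : ∀ y → Classified y
  classify = <-rec Classified classify-step

Dichotomy⇒characterisation : ∀ ℓ x y z → Dichotomy (suc ℓ) x y z →
  ((¬ V (2 + ℓ) y → y ∸ x ≢ z ∸ y) × (y ∸ x ≢ z ∸ y → ¬ V (2 + ℓ) y))
  × (¬ V (2 + ℓ) y → (z ∸ x ≡ alphaBar y) × (alphaBar y ≡ fib (suc ℓ)))
Dichotomy⇒characterisation ℓ _ _ _ (inj₁ (vy , y∸x≡z∸y)) =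
  ((λ ¬vy → contradiction vy ¬vy) , contradiction y∸x≡z∸y) , (λ ¬vy → contradiction vy ¬vy)
Dichotomy⇒characterisation ℓ _ _ _ (inj₂ (αy≡fib[1+ℓ] , y∸x≢z∸y , width)) =
  ((λ _ → y∸x≢z∸y) , (λ _ vy → <⇒≱ (fib-<-suc ℓ) (subst (fib (2 + ℓ) ≤_) αy≡fib[1+ℓ] vy))) ,
  (λ _ → trans width (sym αy≡fib[1+ℓ]) , αy≡fib[1+ℓ])

proposition4p10 : (ℓ : ℕ) → 3 ≤ ℓ → (x y z : ℕ) → Consecutive3 ℓ x y z →
    ((¬ V (suc ℓ) y → y ∸ x ≢ z ∸ y) × (y ∸ x ≢ z ∸ y → ¬ V (suc ℓ) y))
    × (¬ V (suc ℓ) y → (z ∸ x ≡ alphaBar y) × (alphaBar y ≡ fib ℓ))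
proposition4p10 (suc (suc (suc m))) (s≤s (s≤s (s≤s z≤n))) x y z c =
  Dichotomy⇒characterisation (2 + m) x y z (Classification.classify m y c)
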